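{- Every graph $H$ is the $\Gamma$-graph of infinitely many graphs; that is, for every graph $H$ there exist infinitely many graphs $G$ whose $\Gamma$-graph is isomorphic to $H$.
   Context: For a graph $G$, a dominating set $S$ is minimal dominating if no proper subset of $S$ is dominating. The upper domination number $\Gamma(G)$ is the maximum cardinality of a minimal dominating set, and a $\Gamma$-set is a minimal dominating set of cardinality $\Gamma(G)$. The $\Gamma$-graph of $G$ has one vertex for each $\Gamma$-set of $G$, and the vertices corresponding to $S_u,S_w$ are adjacent iff there exist $u'\in S_u$, $w'\in S_w$ with $u'w'\in E(G)$ and $S_w=(S_u-\{u'\})\cup\{w'\}$. -}

module Defs where

open import Data.Nat using (ℕ; _≤_)
open import Data.Bool using (Bool; true; false)
open import Data.Fin using (Fin)
open import Data.Fin.Subset using (Subset; _∈_; _∉_; _⊂_; _∪_; _-_; ⁅_⁆; ∣_∣)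
open import Data.Product using (Σ; ∃; ∃-syntax; _×_; _,_)
open import Data.Sum using (_⊎_)
open import Relation.Nullary using (¬_)
open import Relation.Binary.PropositionalEquality using (_≡_)
open import Function.Bundles using (_↔_; Inverse)
open import Function.Definitions using (Injective)

record Graph : Set where
  field
    n     : ℕ
    adj   : Fin n → Fin n → Bool
    sym   : ∀ u v → adj u v ≡ adj v u
    irrefl : ∀ v → adj v v ≡ false

open Graph public

_⊢_~_ : (G : Graph) → Fin (n G) → Fin (n G) → Set
G ⊢ u ~ v = adj G u v ≡ true

Dominating : (G : Graph) → Subset (n G) → Set
Dominating G S = ∀ v → v ∈ S ⊎ (∃[ u ] (u ∈ S × G ⊢ u ~ v))

MinimalDominating : (G : Graph) → Subset (n G) → Set
MinimalDominating G S = Dominating G S × (∀ T → T ⊂ S → ¬ Dominating G T)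

IsΓSet : (G : Graph) → Subset (n G) → Set
IsΓSet G S = MinimalDominating G S × (∀ T → MinimalDominating G T → ∣ T ∣ ≤ ∣ S ∣)

ΓAdj : (G : Graph) → Subset (n G) → Subset (n G) → Set
ΓAdj G Su Sw = ∃[ u′ ] ∃[ w′ ]
  (u′ ∈ Su × w′ ∈ Sw × G ⊢ u′ ~ w′ × Sw ≡ (Su - u′) ∪ ⁅ w′ ⁆)

ΓGraphIso : (G H : Graph) → Set
ΓGraphIso G H = Σ (Fin (n H) → Subset (n G)) λ f →
    (∀ i → IsΓSet G (f i))
  × Injective _≡_ _≡_ f
  × (∀ S → IsΓSet G S → ∃[ i ] f i ≡ S)
  × (∀ i j → (H ⊢ i ~ j → ΓAdj G (f i) (f j)) × (ΓAdj G (f i) (f j) → H ⊢ i ~ j))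

_≅_ : Graph → Graph → Set
G ≅ G′ = Σ (Fin (n G) ↔ Fin (n G′)) λ φ →
  ∀ u v → adj G u v ≡ adj G′ (Inverse.to φ u) (Inverse.to φ v)

module Submission where

-- For m > k let G(H, m) consist of a copy X = {x_i} of H, two m-cliques
-- C = {c_a} and Q = {q_a} joined by the perfect matching c_a q_a, a vertex r
-- adjacent to X ∪ Q and a vertex t adjacent to X ∪ C; moreover X is completely
-- joined to C.  The sets S_i = C ∪ {x_i} are minimal dominating of size m + 1
-- (c_a has private neighbour q_a, x_i has private neighbour r), and a case
-- analysis shows that every other minimal dominating set has at most k + 1 ≤ m
-- vertices.  Hence the Γ-sets of G are exactly the S_i; S_i and S_j differ by
-- the swap x_i ↦ x_j, which is a Γ-graph edge iff x_i x_j ∈ E(H).  Choosing m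
-- large makes G larger than any given finite list of graphs, hence isomorphic
-- to none of them.

open import Defs
open import Data.Nat using (ℕ; zero; suc; _+_; _≤_; _<_; z≤n; s≤s)
open import Data.Nat.Properties
  using (≤-trans; ≤-reflexive; <⇒≤; <⇒≱; <-irrefl; ≤-<-trans; +-comm; +-monoʳ-≤; +-suc; n≤1+n; m≤m+n; m≤n+m; module ≤-Reasoning)
open import Data.Bool using (Bool; true; false; not)
open import Data.Bool.Properties using () renaming (_≟_ to _≟ᵇ_)
open import Data.Fin using (Fin; zero; suc; _↑ˡ_; _↑ʳ_; splitAt; fromℕ<)
open import Data.Fin.Properties using (splitAt-↑ˡ; splitAt-↑ʳ; splitAt⁻¹-↑ˡ; splitAt⁻¹-↑ʳ; any?; all?; ¬∀⟶∃¬) renaming (_≟_ to _≟ᶠ_)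
open import Data.Fin.Subset using (Subset; _∈_; _∉_; _⊆_; _⊂_; _∪_; _-_; ⁅_⁆; ∣_∣; ⊤; ⊥; inside; outside)
open import Data.Fin.Subset.Properties using (_∈?_; ∉⊥; x∈⁅x⁆; x∈⁅y⁆⇒x≡y; ⊆-antisym; p⊆q⇒∣p∣≤∣q∣; x∈p∪q⁻; x∈p∪q⁺; p─q⊆p; x∈p∧x≢y⇒x∈p-y; x∈p⇒p-x⊂p; x∈p⇒∣p-x∣<∣p∣; ∣⊥∣≡0; ∣⁅x⁆∣≡1; ∪-identityʳ)
open import Data.Fin.Permutation using (↔⇒≡)
open import Data.Vec using ([]; _∷_; _++_; here; there)
open import Data.List using (List; []; _∷_)
open import Data.List.Relation.Unary.All using (All; []; _∷_)
open import Data.Product using (Σ; ∃-syntax; _×_; _,_; proj₁; proj₂)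
import Data.Product as Product
open import Data.Sum using (_⊎_; inj₁; inj₂; [_,_])
import Data.Sum as Sum
open import Data.Empty using (⊥-elim)
open import Function using (_∘_; case_of_)
open import Function.Bundles using (_↔_; Inverse; mk↔ₛ′; mk⇔)
open import Function.Construct.Identity using (↔-id)
open import Relation.Nullary using (¬_; Dec; yes; no; does)
open import Relation.Nullary.Decidable using (dec-true; does-⇔; _⊎-dec_)
open import Relation.Binary.PropositionalEquality
  using (_≡_; _≢_; refl; trans; cong; cong₂; subst; subst₂; ≢-sym) renaming (sym to ≡-sym)

-- The b elements following the first a elements of Fin (a + (b + c)); the
-- vertex classes X and C of the construction are such blocks.
block : ∀ a b c → Subset (a + (b + c))
block a b c = ⊥ {a} ++ (⊤ {b} ++ ⊥ {c})

∈-block : ∀ a c {b} (y : Fin b) → a ↑ʳ (y ↑ˡ c) ∈ block a b c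
∈-block zero    c zero    = here
∈-block zero    c (suc y) = there (∈-block zero c y)
∈-block (suc a) c y       = there (∈-block a c y)

block⁻ : ∀ a b c {i} → i ∈ block a b c → ∃[ y ] i ≡ a ↑ʳ (y ↑ˡ c)
block⁻ zero    zero    c p         = ⊥-elim (∉⊥ p)
block⁻ zero    (suc b) c here      = zero , refl
block⁻ zero    (suc b) c (there p) = Product.map suc (cong suc) (block⁻ zero b c p)
block⁻ (suc a) b       c (there p) = Product.map₂ (cong suc) (block⁻ a b c p)

∣block∣ : ∀ a b c → ∣ block a b c ∣ ≡ b
∣block∣ (suc a) b       c = ∣block∣ a b c
∣block∣ zero    (suc b) c = cong suc (∣block∣ zero b c)
∣block∣ zero    zero    c = ∣⊥∣≡0 c

∣p∪q∣≤∣p∣+∣q∣ : ∀ {n} (p q : Subset n) → ∣ p ∪ q ∣ ≤ ∣ p ∣ + ∣ q ∣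
∣p∪q∣≤∣p∣+∣q∣ []            []            = z≤n
∣p∪q∣≤∣p∣+∣q∣ (inside ∷ p)  (inside ∷ q)  = s≤s (≤-trans (∣p∪q∣≤∣p∣+∣q∣ p q) (+-monoʳ-≤ ∣ p ∣ (n≤1+n ∣ q ∣)))
∣p∪q∣≤∣p∣+∣q∣ (inside ∷ p)  (outside ∷ q) = s≤s (∣p∪q∣≤∣p∣+∣q∣ p q)
∣p∪q∣≤∣p∣+∣q∣ (outside ∷ p) (inside ∷ q)  = subst (suc ∣ p ∪ q ∣ ≤_) (≡-sym (+-suc ∣ p ∣ ∣ q ∣)) (s≤s (∣p∪q∣≤∣p∣+∣q∣ p q))
∣p∪q∣≤∣p∣+∣q∣ (outside ∷ p) (outside ∷ q) = ∣p∪q∣≤∣p∣+∣q∣ p q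

∣p∪⁅x⁆∣≡1+∣p∣ : ∀ {n} (p : Subset n) {x} → x ∉ p → ∣ p ∪ ⁅ x ⁆ ∣ ≡ suc ∣ p ∣
∣p∪⁅x⁆∣≡1+∣p∣ (inside ∷ p)  {zero}  x∉p = ⊥-elim (x∉p here)
∣p∪⁅x⁆∣≡1+∣p∣ (outside ∷ p) {zero}  _   = cong (suc ∘ ∣_∣) (∪-identityʳ p)
∣p∪⁅x⁆∣≡1+∣p∣ (inside ∷ p)  {suc x} x∉p = cong suc (∣p∪⁅x⁆∣≡1+∣p∣ p (x∉p ∘ there))
∣p∪⁅x⁆∣≡1+∣p∣ (outside ∷ p) {suc x} x∉p = ∣p∪⁅x⁆∣≡1+∣p∣ p (x∉p ∘ there)

∣⁅i⁆∪⁅j⁆∣≤2 : ∀ {n} (i j : Fin n) → ∣ ⁅ i ⁆ ∪ ⁅ j ⁆ ∣ ≤ 2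
∣⁅i⁆∪⁅j⁆∣≤2 i j = ≤-trans (∣p∪q∣≤∣p∣+∣q∣ ⁅ i ⁆ ⁅ j ⁆) (≤-reflexive (cong₂ _+_ (∣⁅x⁆∣≡1 i) (∣⁅x⁆∣≡1 j)))

x∉p-x : ∀ {n} (p : Subset n) x → x ∉ p - x
x∉p-x (_ ∷ p) (suc x) (there x∈p-x) = x∉p-x p x x∈p-x

module _ (G : Graph) where

  Covers : Fin (n G) → Fin (n G) → Set
  Covers u v = u ≡ v ⊎ G ⊢ u ~ v

  covers? : ∀ u v → Dec (Covers u v)
  covers? u v = (u ≟ᶠ v) ⊎-dec (adj G u v ≟ᵇ true)

  loopless : ∀ {u} → ¬ (G ⊢ u ~ u)
  loopless {u} u~u with trans (≡-sym (irrefl G u)) u~u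
  ... | ()

  dominator : ∀ {S} → Dominating G S → ∀ v → ∃[ u ] (u ∈ S × Covers u v)
  dominator dom v with dom v
  ... | inj₁ v∈S              = v , v∈S , inj₁ refl
  ... | inj₂ (u , u∈S , u~v)  = u , u∈S , inj₂ u~v

  dominating : ∀ {S} → (∀ v → ∃[ u ] (u ∈ S × Covers u v)) → Dominating G S
  dominating cover v with cover v
  ... | u , u∈S , inj₁ refl = inj₁ u∈S
  ... | u , u∈S , inj₂ u~v  = inj₂ (u , u∈S , u~v)

  -- A dominating set in which every member d has a private vertex p
  -- (covered by no other member) is minimal: dropping d leaves p undominated.
  private⇒minimal : ∀ {S} → Dominating G S →
    (∀ d → d ∈ S → ∃[ p ] (∀ u → u ∈ S → Covers u p → u ≡ d)) →
    MinimalDominating G S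
  private⇒minimal dom private-vertex = dom , not-dominating
    where
    not-dominating : ∀ T → T ⊂ _ → ¬ Dominating G T
    not-dominating T (T⊆S , d , d∈S , d∉T) domT
      with private-vertex d d∈S
    ... | p , only-d with dominator domT p
    ...   | u , u∈T , u▹p = d∉T (subst (_∈ T) (only-d u (T⊆S u∈T) u▹p) u∈T)

  not-redundant : ∀ {S d} → MinimalDominating G S → d ∈ S →
    ¬ (∀ v → Covers d v → ∃[ u ] (u ∈ S × u ≢ d × Covers u v))
  not-redundant {S} {d} (dom , minimal) d∈S others =
    minimal (S - d) (x∈p⇒p-x⊂p d∈S) (dominating cover)
    where
    cover : ∀ v → ∃[ u ] (u ∈ S - d × Covers u v)
    cover v with covers? d v
    ... | yes d▹v = let (u , u∈S , u≢d , u▹v) = others v d▹v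
                    in u , x∈p∧x≢y⇒x∈p-y u∈S u≢d , u▹v
    ... | no ¬d▹v = let (u , u∈S , u▹v) = dominator dom v
                    in u , x∈p∧x≢y⇒x∈p-y u∈S (λ { refl → ¬d▹v u▹v }) , u▹v

  covering-pair : ∀ {S u w} → MinimalDominating G S → u ∈ S → w ∈ S →
    (∀ v → Covers u v ⊎ Covers w v) → S ⊆ ⁅ u ⁆ ∪ ⁅ w ⁆
  covering-pair {S} {u} {w} md u∈S w∈S cover {d} d∈S with d ≟ᶠ u | d ≟ᶠ w
  ... | yes refl | _        = x∈p∪q⁺ (inj₁ (x∈⁅x⁆ d))
  ... | no _     | yes refl = x∈p∪q⁺ (inj₂ (x∈⁅x⁆ d))
  ... | no d≢u   | no d≢w   = ⊥-elim (not-redundant md d∈S λ v _ →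
    [ (λ u▹v → u , u∈S , ≢-sym d≢u , u▹v) , (λ w▹v → w , w∈S , ≢-sym d≢w , w▹v) ] (cover v))

  minimal-contains : ∀ {S T} → MinimalDominating G S → T ⊆ S → Dominating G T → S ≡ T
  minimal-contains {S} {T} (_ , minimal) T⊆S domT = ⊆-antisym S⊆T T⊆S
    where
    S⊆T : S ⊆ T
    S⊆T {i} i∈S with i ∈? T
    ... | yes i∈T = i∈T
    ... | no i∉T  = ⊥-elim (minimal T (T⊆S , i , i∈S , i∉T) domT)

  swap-removes : ∀ {S u w} → G ⊢ u ~ w → u ∉ (S - u) ∪ ⁅ w ⁆
  swap-removes {S} {u} {w} u~w u∈S′ with x∈p∪q⁻ (S - u) ⁅ w ⁆ u∈S′
  ... | inj₁ u∈S-u = x∉p-x S u u∈S-u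
  ... | inj₂ u∈⁅w⁆ with x∈⁅y⁆⇒x≡y w u∈⁅w⁆
  ...   | refl = loopless u~w

module ΓSetsByClassification
  (G : Graph) {k s : ℕ} (f : Fin k → Subset (n G))
  (f-minimal : ∀ i → MinimalDominating G (f i))
  (∣f∣≡s : ∀ i → ∣ f i ∣ ≡ s)
  (classify : ∀ D → MinimalDominating G D → (∃[ b ] D ≡ f b) ⊎ ∣ D ∣ < s)
  where

  f-Γ : ∀ i → IsΓSet G (f i)
  f-Γ i = f-minimal i , maximum
    where
    maximum : ∀ T → MinimalDominating G T → ∣ T ∣ ≤ ∣ f i ∣
    maximum T md with classify T md
    ... | inj₁ (b , refl) = ≤-reflexive (trans (∣f∣≡s b) (≡-sym (∣f∣≡s i)))
    ... | inj₂ ∣T∣<s      = subst (∣ T ∣ ≤_) (≡-sym (∣f∣≡s i)) (<⇒≤ ∣T∣<s)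

  -- Any Γ-set has size at least s = ∣ f i₀ ∣, so it is one of the f b.
  f-onto : Fin k → ∀ S → IsΓSet G S → ∃[ i ] f i ≡ S
  f-onto i₀ S (md , maximum) with classify S md
  ... | inj₁ (b , S≡fb) = b , ≡-sym S≡fb
  ... | inj₂ ∣S∣<s      =
    ⊥-elim (<⇒≱ ∣S∣<s (subst (_≤ ∣ S ∣) (∣f∣≡s i₀) (maximum (f i₀) (f-minimal i₀))))

≅⇒same-order : ∀ {G G′} → G ≅ G′ → n G ≡ n G′
≅⇒same-order (φ , _) = ↔⇒≡ φ

totalOrder : List Graph → ℕ
totalOrder []        = 0
totalOrder (G ∷ Gs)  = n G + totalOrder Gs

too-large : ∀ G Gs → totalOrder Gs < n G → All (λ G′ → ¬ (G ≅ G′)) Gs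
too-large G []        _  = []
too-large G (G′ ∷ Gs) lt =
  (λ iso → <-irrefl (≡-sym (≅⇒same-order {G} {G′} iso)) (≤-<-trans (m≤m+n (n G′) (totalOrder Gs)) lt))
  ∷ too-large G Gs (≤-<-trans (m≤n+m (totalOrder Gs) (n G′)) lt)

_⊕_ : ∀ a {B : Set} {b} → B ↔ Fin b → (Fin a ⊎ B) ↔ Fin (a + b)
_⊕_ a {B} {b} L = mk↔ₛ′ to from to∘from from∘to
  where
  open Inverse L using () renaming (to to toB; from to fromB; strictlyInverseˡ to toB∘fromB; strictlyInverseʳ to fromB∘toB)
  to : Fin a ⊎ B → Fin (a + b)
  to (inj₁ i) = i ↑ˡ b
  to (inj₂ x) = a ↑ʳ toB x
  from : Fin (a + b) → Fin a ⊎ B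
  from i = Sum.map₂ fromB (splitAt a i)
  to∘from : ∀ i → to (from i) ≡ i
  to∘from i with splitAt a i in eq
  ... | inj₁ j = splitAt⁻¹-↑ˡ eq
  ... | inj₂ y = trans (cong (a ↑ʳ_) (toB∘fromB y)) (splitAt⁻¹-↑ʳ eq)
  from∘to : ∀ x → from (to x) ≡ x
  from∘to (inj₁ i) rewrite splitAt-↑ˡ a i b = refl
  from∘to (inj₂ x) rewrite splitAt-↑ʳ a b (toB x) = cong inj₂ (fromB∘toB x)

module Presented {V : Set} {N : ℕ} (layout : V ↔ Fin N) (adjV : V → V → Bool)
  (adjV-sym : ∀ u v → adjV u v ≡ adjV v u) (adjV-irrefl : ∀ v → adjV v v ≡ false) where

  open Inverse layout public using ()
    renaming (to to enc; from to dec; strictlyInverseˡ to enc∘dec; strictlyInverseʳ to dec∘enc)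

  graph : Graph
  graph = record
    { n = N ; adj = λ i j → adjV (dec i) (dec j)
    ; sym = λ i j → adjV-sym (dec i) (dec j) ; irrefl = λ i → adjV-irrefl (dec i) }

  enc-injective : ∀ {u v} → enc u ≡ enc v → u ≡ v
  enc-injective {u} {v} e = trans (≡-sym (dec∘enc u)) (trans (cong dec e) (dec∘enc v))

  everywhere : ∀ {P : Fin N → Set} → (∀ v → P (enc v)) → ∀ i → P i
  everywhere {P} h i = subst P (enc∘dec i) (h (dec i))

  edge⁺ : ∀ {u v} → adjV u v ≡ true → graph ⊢ enc u ~ enc v
  edge⁺ {u} {v} = subst₂ (λ a b → adjV a b ≡ true) (≡-sym (dec∘enc u)) (≡-sym (dec∘enc v))

  edge⁻ : ∀ {u v} → graph ⊢ enc u ~ enc v → adjV u v ≡ true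
  edge⁻ {u} {v} = subst₂ (λ a b → adjV a b ≡ true) (dec∘enc u) (dec∘enc v)

  _▹_ : V → V → Set
  u ▹ v = u ≡ v ⊎ adjV u v ≡ true

  ▹⇒Covers : ∀ {u v} → u ▹ v → Covers graph (enc u) (enc v)
  ▹⇒Covers = Sum.map (cong enc) edge⁺

  Covers⇒▹ : ∀ {u v} → Covers graph (enc u) (enc v) → u ▹ v
  Covers⇒▹ = Sum.map enc-injective edge⁻

  dominatorV : ∀ {S} → Dominating graph S → ∀ v → ∃[ u ] (enc u ∈ S × u ▹ v)
  dominatorV {S} dom v with dominator graph dom (enc v)
  ... | i , i∈S , i▹v =
    dec i , subst (_∈ S) (≡-sym (enc∘dec i)) i∈S
          , Covers⇒▹ (subst (λ j → Covers graph j (enc v)) (≡-sym (enc∘dec i)) i▹v)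

  dominatingV : ∀ {S} → (∀ v → ∃[ u ] (enc u ∈ S × u ▹ v)) → Dominating graph S
  dominatingV cover = dominating graph (everywhere λ v →
    let (u , u∈S , u▹v) = cover v in enc u , u∈S , ▹⇒Covers u▹v)

  ⊆V : ∀ {S T} → (∀ v → enc v ∈ S → enc v ∈ T) → S ⊆ T
  ⊆V h {i} = everywhere h i

  private⇒minimalV : ∀ {S} → Dominating graph S →
    (∀ d → enc d ∈ S → ∃[ p ] (∀ u → enc u ∈ S → u ▹ p → u ≡ d)) →
    MinimalDominating graph S
  private⇒minimalV {S} dom private-vertex = private⇒minimal graph dom (everywhere λ d d∈S →
    let (p , only-d) = private-vertex d d∈S
    in enc p , everywhere λ u u∈S u▹p → cong enc (only-d u u∈S (Covers⇒▹ u▹p)))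

  not-redundantV : ∀ {S d} → MinimalDominating graph S → enc d ∈ S →
    ¬ (∀ v → d ▹ v → ∃[ u ] (enc u ∈ S × u ≢ d × u ▹ v))
  not-redundantV md d∈S others = not-redundant graph md d∈S (everywhere λ v d▹v →
    let (u , u∈S , u≢d , u▹v) = others v (Covers⇒▹ d▹v)
    in enc u , u∈S , u≢d ∘ enc-injective , ▹⇒Covers u▹v)

  covering-pairV : ∀ {S u w} → MinimalDominating graph S → enc u ∈ S → enc w ∈ S →
    (∀ v → u ▹ v ⊎ w ▹ v) → S ⊆ ⁅ enc u ⁆ ∪ ⁅ enc w ⁆
  covering-pairV md u∈S w∈S cover =
    covering-pair graph md u∈S w∈S (everywhere (Sum.map ▹⇒Covers ▹⇒Covers ∘ cover))

-- The vertices of G(H, m): x_a (a ∈ V(H)), c_a and q_a (a < m), r and t.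
pattern vx a = inj₁ a
pattern vc a = inj₂ (inj₁ a)
pattern vq a = inj₂ (inj₂ (inj₁ a))
pattern vr   = inj₂ (inj₂ (inj₂ zero))
pattern vt   = inj₂ (inj₂ (inj₂ (suc zero)))

module Gadget (H : Graph) (m′ : ℕ) where

  k : ℕ
  k = n H

  m : ℕ
  m = suc m′

  V : Set
  V = Fin k ⊎ (Fin m ⊎ (Fin m ⊎ Fin 2))

  N : ℕ
  N = k + (m + (m + 2))

  layout : V ↔ Fin N
  layout = k ⊕ (m ⊕ (m ⊕ ↔-id (Fin 2)))

  _≡ᵇ_ : Fin m → Fin m → Bool
  a ≡ᵇ b = does (a ≟ᶠ b)

  ≡ᵇ-refl : ∀ a → (a ≡ᵇ a) ≡ true
  ≡ᵇ-refl a = dec-true (a ≟ᶠ a) refl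

  ≡ᵇ-sym : ∀ a b → (a ≡ᵇ b) ≡ (b ≡ᵇ a)
  ≡ᵇ-sym a b = does-⇔ (mk⇔ ≡-sym ≡-sym) (a ≟ᶠ b) (b ≟ᶠ a)

  ≡ᵇ⇒≡ : ∀ a b → (a ≡ᵇ b) ≡ true → a ≡ b
  ≡ᵇ⇒≡ a b e with a ≟ᶠ b
  ≡ᵇ⇒≡ a b _  | yes a≡b = a≡b
  ≡ᵇ⇒≡ a b () | no _

  adjV : V → V → Bool
  adjV (vx a) (vx b) = adj H a b
  adjV (vx _) (vc _) = true
  adjV (vx _) (vq _) = false
  adjV (vx _) vr     = true
  adjV (vx _) vt     = true
  adjV (vc _) (vx _) = true
  adjV (vc a) (vc b) = not (a ≡ᵇ b)
  adjV (vc a) (vq b) = a ≡ᵇ b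
  adjV (vc _) vr     = false
  adjV (vc _) vt     = true
  adjV (vq _) (vx _) = false
  adjV (vq a) (vc b) = b ≡ᵇ a
  adjV (vq a) (vq b) = not (a ≡ᵇ b)
  adjV (vq _) vr     = true
  adjV (vq _) vt     = false
  adjV vr     (vx _) = true
  adjV vr     (vc _) = false
  adjV vr     (vq _) = true
  adjV vr     vr     = false
  adjV vr     vt     = false
  adjV vt     (vx _) = true
  adjV vt     (vc _) = true
  adjV vt     (vq _) = false
  adjV vt     vr     = false
  adjV vt     vt     = false

  adjV-sym : ∀ u v → adjV u v ≡ adjV v u
  adjV-sym (vx a) (vx b) = sym H a b
  adjV-sym (vx _) (vc _) = refl
  adjV-sym (vx _) (vq _) = refl
  adjV-sym (vx _) vr     = refl
  adjV-sym (vx _) vt     = refl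
  adjV-sym (vc _) (vx _) = refl
  adjV-sym (vc a) (vc b) = cong not (≡ᵇ-sym a b)
  adjV-sym (vc _) (vq _) = refl
  adjV-sym (vc _) vr     = refl
  adjV-sym (vc _) vt     = refl
  adjV-sym (vq _) (vx _) = refl
  adjV-sym (vq _) (vc _) = refl
  adjV-sym (vq a) (vq b) = cong not (≡ᵇ-sym a b)
  adjV-sym (vq _) vr     = refl
  adjV-sym (vq _) vt     = refl
  adjV-sym vr     (vx _) = refl
  adjV-sym vr     (vc _) = refl
  adjV-sym vr     (vq _) = refl
  adjV-sym vr     vr     = refl
  adjV-sym vr     vt     = refl
  adjV-sym vt     (vx _) = refl
  adjV-sym vt     (vc _) = refl
  adjV-sym vt     (vq _) = refl
  adjV-sym vt     vr     = refl
  adjV-sym vt     vt     = refl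

  adjV-irrefl : ∀ v → adjV v v ≡ false
  adjV-irrefl (vx a) = irrefl H a
  adjV-irrefl (vc a) = cong not (≡ᵇ-refl a)
  adjV-irrefl (vq a) = cong not (≡ᵇ-refl a)
  adjV-irrefl vr     = refl
  adjV-irrefl vt     = refl

  open Presented layout adjV adjV-sym adjV-irrefl public

  G : Graph
  G = graph

  C-clique : ∀ a b → vc a ▹ vc b
  C-clique a b with a ≟ᶠ b
  ... | yes refl = inj₁ refl
  ... | no _     = inj₂ refl

  data Q⁺ : V → Set where
    r∈Q⁺ : Q⁺ vr
    q∈Q⁺ : ∀ a → Q⁺ (vq a)

  Q⁺-clique : ∀ {w v} → Q⁺ w → Q⁺ v → w ▹ v
  Q⁺-clique r∈Q⁺     r∈Q⁺     = inj₁ refl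
  Q⁺-clique r∈Q⁺     (q∈Q⁺ _) = inj₂ refl
  Q⁺-clique (q∈Q⁺ _) r∈Q⁺     = inj₂ refl
  Q⁺-clique (q∈Q⁺ a) (q∈Q⁺ b) with a ≟ᶠ b
  ... | yes refl = inj₁ refl
  ... | no _     = inj₂ refl

  c▹q⇒≡ : ∀ {a b} → vc b ▹ vq a → b ≡ a
  c▹q⇒≡ {a} {b} (inj₂ e) = ≡ᵇ⇒≡ b a e

  Cs : Subset N
  Cs = block k m (m + 2)

  Xs : Subset N
  Xs = block 0 k (m + (m + 2))

  S : Fin k → Subset N
  S i = Cs ∪ ⁅ enc (vx i) ⁆

  c∈S : ∀ {i} a → enc (vc a) ∈ S i
  c∈S a = x∈p∪q⁺ (inj₁ (∈-block k (m + 2) a))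

  x∈S : ∀ i → enc (vx i) ∈ S i
  x∈S i = x∈p∪q⁺ (inj₂ (x∈⁅x⁆ (enc (vx i))))

  S⁻ : ∀ {i y} → y ∈ S i → (∃[ a ] y ≡ enc (vc a)) ⊎ y ≡ enc (vx i)
  S⁻ {i} {y} y∈S with x∈p∪q⁻ Cs ⁅ enc (vx i) ⁆ y∈S
  ... | inj₁ y∈C = inj₁ (block⁻ k m (m + 2) y∈C)
  ... | inj₂ y∈x = inj₂ (x∈⁅y⁆⇒x≡y (enc (vx i)) y∈x)

  S⁻V : ∀ {i} v → enc v ∈ S i → (∃[ a ] v ≡ vc a) ⊎ v ≡ vx i
  S⁻V _ = Sum.map (Product.map₂ enc-injective) enc-injective ∘ S⁻

  ∣S∣ : ∀ i → ∣ S i ∣ ≡ suc m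
  ∣S∣ i = trans (∣p∪⁅x⁆∣≡1+∣p∣ Cs x∉C) (cong suc (∣block∣ k m (m + 2)))
    where
    x∉C : enc (vx i) ∉ Cs
    x∉C x∈C with enc-injective {vx i} {vc _} (Product.proj₂ (block⁻ k m (m + 2) x∈C))
    ... | ()

  -- C covers everything except r, which x_i covers.
  S-dominating : ∀ i → Dominating G (S i)
  S-dominating i = dominatingV cover
    where
    cover : ∀ v → ∃[ u ] (enc u ∈ S i × u ▹ v)
    cover (vx _) = vc zero , c∈S zero , inj₂ refl
    cover (vc a) = vc a , c∈S a , inj₁ refl
    cover (vq a) = vc a , c∈S a , inj₂ (≡ᵇ-refl a)
    cover vr     = vx i , x∈S i , inj₂ refl
    cover vt     = vc zero , c∈S zero , inj₂ refl

  -- c_a has private vertex q_a and x_i has private vertex r.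
  S-minimal : ∀ i → MinimalDominating G (S i)
  S-minimal i = private⇒minimalV (S-dominating i) private-vertex
    where
    private-vertex : ∀ d → enc d ∈ S i → ∃[ p ] (∀ u → enc u ∈ S i → u ▹ p → u ≡ d)
    private-vertex d d∈S with S⁻V d d∈S
    ... | inj₁ (a , refl) = vq a , only-c
      where
      only-c : ∀ u → enc u ∈ S i → u ▹ vq a → u ≡ vc a
      only-c u u∈S u▹q with S⁻V u u∈S | u▹q
      ... | inj₁ (b , refl) | _        = cong vc (c▹q⇒≡ u▹q)
      ... | inj₂ refl       | inj₂ ()
    ... | inj₂ refl = vr , only-x
      where
      only-x : ∀ u → enc u ∈ S i → u ▹ vr → u ≡ vx i
      only-x u u∈S u▹r with S⁻V u u∈S | u▹r
      ... | inj₁ (b , refl) | inj₂ ()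
      ... | inj₂ refl       | _       = refl

  S-swap : ∀ i j → S j ≡ (S i - enc (vx i)) ∪ ⁅ enc (vx j) ⁆
  S-swap i j = ⊆-antisym to-swap from-swap
    where
    to-swap : S j ⊆ (S i - enc (vx i)) ∪ ⁅ enc (vx j) ⁆
    to-swap y∈S with S⁻ y∈S
    ... | inj₁ (a , refl) = x∈p∪q⁺ (inj₁ (x∈p∧x≢y⇒x∈p-y (c∈S a) (λ e → c≢x (enc-injective e))))
      where
      c≢x : vc a ≢ vx i
      c≢x ()
    ... | inj₂ refl = x∈p∪q⁺ (inj₂ (x∈⁅x⁆ _))
    from-swap : (S i - enc (vx i)) ∪ ⁅ enc (vx j) ⁆ ⊆ S j
    from-swap {y} y∈ with x∈p∪q⁻ (S i - enc (vx i)) _ y∈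
    ... | inj₂ y∈x = subst (_∈ S j) (≡-sym (x∈⁅y⁆⇒x≡y _ y∈x)) (x∈S j)
    ... | inj₁ y∈S-x with S⁻ (p─q⊆p (S i) _ y∈S-x)
    ...   | inj₁ (a , refl) = c∈S a
    ...   | inj₂ refl       = ⊥-elim (x∉p-x (S i) _ y∈S-x)

  Small : Subset N → Set
  Small D = ∣ D ∣ ≤ suc k

  -- Cases: D meets C and
  -- Q⁺ (then D is a pair); D meets C but not Q⁺ (then D = S_b); D misses C and
  -- X (then D is a pair); D misses C but meets X.
  module Classification (k≥1 : 1 ≤ k) (D : Subset N) (md : MinimalDominating G D) where

    pair-small : ∀ {i j} → D ⊆ ⁅ i ⁆ ∪ ⁅ j ⁆ → Small D
    pair-small {i} {j} D⊆ = ≤-trans (p⊆q⇒∣p∣≤∣q∣ D⊆) (≤-trans (∣⁅i⁆∪⁅j⁆∣≤2 i j) (s≤s k≥1))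

    -- c_a covers X ∪ C ∪ {t}, a Q⁺-vertex covers Q⁺.
    with-c-and-Q⁺ : ∀ {a w} → enc (vc a) ∈ D → Q⁺ w → enc w ∈ D → Small D
    with-c-and-Q⁺ {a} {w} c∈D qw w∈D = pair-small (covering-pairV md c∈D w∈D cover)
      where
      cover : ∀ v → vc a ▹ v ⊎ w ▹ v
      cover (vx _) = inj₁ (inj₂ refl)
      cover (vc b) = inj₁ (C-clique a b)
      cover (vq b) = inj₂ (Q⁺-clique qw (q∈Q⁺ b))
      cover vr     = inj₂ (Q⁺-clique qw r∈Q⁺)
      cover vt     = inj₁ (inj₂ refl)

    -- Without Q⁺-vertices, each q_a forces c_a and r forces some x_b, so D ⊇ S_b.
    without-Q⁺ : (∀ {w} → Q⁺ w → enc w ∉ D) → ∃[ b ] D ≡ S b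
    without-Q⁺ noQ = b , minimal-contains G md (⊆V S⊆D) (S-dominating b)
      where
      C⊆D : ∀ a → enc (vc a) ∈ D
      C⊆D a = case dominatorV (proj₁ md) (vq a) of λ where
        (vc b , b∈D , b▹q) → subst (λ z → enc (vc z) ∈ D) (c▹q⇒≡ b▹q) b∈D
        (vq b , b∈D , _)   → ⊥-elim (noQ (q∈Q⁺ b) b∈D)
        (vr   , r∈D , _)   → ⊥-elim (noQ r∈Q⁺ r∈D)
        (vx _ , _   , inj₂ ())
        (vt   , _   , inj₂ ())
      x-in-D : ∃[ b ] enc (vx b) ∈ D
      x-in-D = case dominatorV (proj₁ md) vr of λ where
        (vx b , b∈D , _) → b , b∈D
        (vq b , b∈D , _) → ⊥-elim (noQ (q∈Q⁺ b) b∈D)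
        (vr   , r∈D , _) → ⊥-elim (noQ r∈Q⁺ r∈D)
        (vc _ , _   , inj₂ ())
        (vt   , _   , inj₂ ())
      b : Fin k
      b = proj₁ x-in-D
      S⊆D : ∀ v → enc v ∈ S b → enc v ∈ D
      S⊆D v v∈S = case S⁻V v v∈S of λ where
        (inj₁ (a , refl)) → C⊆D a
        (inj₂ refl)       → proj₂ x-in-D

    module WithoutC (noC : ∀ a → enc (vc a) ∉ D) where

      -- q₀ must be covered by a Q⁺-vertex.
      Q⁺-member : Σ V λ w → Q⁺ w × enc w ∈ D
      Q⁺-member = case dominatorV (proj₁ md) (vq zero) of λ where
        (vq l , l∈D , _) → vq l , q∈Q⁺ l , l∈D
        (vr   , r∈D , _) → vr , r∈Q⁺ , r∈D
        (vc a , a∈D , _) → ⊥-elim (noC a a∈D)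
        (vx _ , _   , inj₂ ())
        (vt   , _   , inj₂ ())

      w : V
      w = proj₁ Q⁺-member

      w∈Q⁺ : Q⁺ w
      w∈Q⁺ = proj₁ (proj₂ Q⁺-member)

      w∈D : enc w ∈ D
      w∈D = proj₂ (proj₂ Q⁺-member)

      -- Without X-vertices, t must be in D; t covers X ∪ C ∪ {t}.
      without-X : (∀ b → enc (vx b) ∉ D) → Small D
      without-X noX = pair-small (covering-pairV md t∈D w∈D cover)
        where
        t∈D : enc vt ∈ D
        t∈D = case dominatorV (proj₁ md) vt of λ where
          (vt   , t∈D , _) → t∈D
          (vx b , b∈D , _) → ⊥-elim (noX b b∈D)
          (vc a , a∈D , _) → ⊥-elim (noC a a∈D)
          (vq _ , _   , inj₂ ())
          (vr   , _   , inj₂ ())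
        cover : ∀ v → vt ▹ v ⊎ w ▹ v
        cover (vx _) = inj₁ (inj₂ refl)
        cover (vc _) = inj₁ (inj₂ refl)
        cover (vq b) = inj₂ (Q⁺-clique w∈Q⁺ (q∈Q⁺ b))
        cover vr     = inj₂ (Q⁺-clique w∈Q⁺ r∈Q⁺)
        cover vt     = inj₁ (inj₁ refl)

      -- When moreover x_b ∈ D, D ⊆ X ∪ {t, w} and D does not contain all of X ∪ {t}.
      module WithX (b : Fin k) (x∈D : enc (vx b) ∈ D) where

        -- A q_l next to another Q⁺-vertex o of D is redundant: o covers Q⁺
        -- and x_b covers c_l.
        q-redundant : ∀ {l o} → Q⁺ o → o ≢ vq l → enc o ∈ D → enc (vq l) ∉ D
        q-redundant {l} {o} qo o≢q o∈D q∈D = not-redundantV md q∈D others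
          where
          others : ∀ v → vq l ▹ v → ∃[ u ] (enc u ∈ D × u ≢ vq l × u ▹ v)
          others (vq e) _ = o , o∈D , o≢q , Q⁺-clique qo (q∈Q⁺ e)
          others vr     _ = o , o∈D , o≢q , Q⁺-clique qo r∈Q⁺
          others (vc e) _ = vx b , x∈D , (λ ()) , inj₂ refl
          others (vx _) (inj₂ ())
          others vt     (inj₂ ())

        Q⁺-distinct : ∀ {v o} → Q⁺ v → Q⁺ o → v ≢ o → enc v ∈ D → ¬ (enc o ∈ D)
        Q⁺-distinct r∈Q⁺     r∈Q⁺     v≢o _   _   = v≢o refl
        Q⁺-distinct (q∈Q⁺ _) qo       v≢o v∈D o∈D = q-redundant qo (≢-sym v≢o) o∈D v∈D
        Q⁺-distinct r∈Q⁺     (q∈Q⁺ _) v≢o v∈D o∈D = q-redundant r∈Q⁺ v≢o v∈D o∈D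

        Q⁺-unique : ∀ {v} → Q⁺ v → enc v ∈ D → v ≡ w
        Q⁺-unique {v} qv v∈D = case enc v ≟ᶠ enc w of λ where
          (yes e)   → enc-injective e
          (no v≢w)  → ⊥-elim (Q⁺-distinct qv w∈Q⁺ (v≢w ∘ cong enc) v∈D w∈D)

        in-w : ∀ {v} → Q⁺ v → enc v ∈ D → enc v ∈ ⁅ enc w ⁆
        in-w qv v∈D = subst (λ z → enc z ∈ ⁅ enc w ⁆) (≡-sym (Q⁺-unique qv v∈D)) (x∈⁅x⁆ _)

        without-t : enc vt ∉ D → Small D
        without-t t∉D = begin
          ∣ D ∣                     ≤⟨ p⊆q⇒∣p∣≤∣q∣ (⊆V D⊆) ⟩
          ∣ Xs ∪ ⁅ enc w ⁆ ∣         ≤⟨ ∣p∪q∣≤∣p∣+∣q∣ Xs _ ⟩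
          ∣ Xs ∣ + ∣ ⁅ enc w ⁆ ∣     ≡⟨ cong₂ _+_ (∣block∣ 0 k (m + (m + 2))) (∣⁅x⁆∣≡1 (enc w)) ⟩
          k + 1                     ≡⟨ +-comm k 1 ⟩
          suc k                     ∎
          where
          open ≤-Reasoning
          D⊆ : ∀ v → enc v ∈ D → enc v ∈ Xs ∪ ⁅ enc w ⁆
          D⊆ (vx a) _   = x∈p∪q⁺ (inj₁ (∈-block 0 (m + (m + 2)) a))
          D⊆ (vc a) v∈D = ⊥-elim (noC a v∈D)
          D⊆ (vq a) v∈D = x∈p∪q⁺ (inj₂ (in-w (q∈Q⁺ a) v∈D))
          D⊆ vr     v∈D = x∈p∪q⁺ (inj₂ (in-w r∈Q⁺ v∈D))
          D⊆ vt     v∈D = ⊥-elim (t∉D v∈D)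

        -- If X ⊆ D then t is redundant: X covers itself and x_b covers C ∪ {t}.
        t-redundant : (∀ e → enc (vx e) ∈ D) → enc vt ∉ D
        t-redundant X⊆D t∈D = not-redundantV md t∈D others
          where
          others : ∀ v → vt ▹ v → ∃[ u ] (enc u ∈ D × u ≢ vt × u ▹ v)
          others vt     _ = vx b , x∈D , (λ ()) , inj₂ refl
          others (vx e) _ = vx e , X⊆D e , (λ ()) , inj₁ refl
          others (vc _) _ = vx b , x∈D , (λ ()) , inj₂ refl
          others (vq _) (inj₂ ())
          others vr     (inj₂ ())

        some-x-missing : enc vt ∈ D → ∃[ e ] enc (vx e) ∉ D
        some-x-missing t∈D = case all? (λ e → enc (vx e) ∈? D) of λ where
          (no ¬all) → ¬∀⟶∃¬ k _ (λ e → enc (vx e) ∈? D) ¬all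
          (yes X⊆D) → ⊥-elim (t-redundant X⊆D t∈D)

        with-t : enc vt ∈ D → Small D
        with-t t∈D = begin
          ∣ D ∣                          ≤⟨ p⊆q⇒∣p∣≤∣q∣ (⊆V D⊆) ⟩
          ∣ A ∪ (⁅ enc vt ⁆ ∪ ⁅ enc w ⁆) ∣ ≤⟨ ∣p∪q∣≤∣p∣+∣q∣ A _ ⟩
          ∣ A ∣ + ∣ ⁅ enc vt ⁆ ∪ ⁅ enc w ⁆ ∣ ≤⟨ +-monoʳ-≤ ∣ A ∣ (∣⁅i⁆∪⁅j⁆∣≤2 (enc vt) (enc w)) ⟩
          ∣ A ∣ + 2                      ≡⟨ +-comm ∣ A ∣ 2 ⟩
          suc (suc ∣ A ∣)                ≤⟨ s≤s ∣A∣<k ⟩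
          suc k                          ∎
          where
          open ≤-Reasoning
          e : Fin k
          e = proj₁ (some-x-missing t∈D)
          A : Subset N
          A = Xs - enc (vx e)
          ∣A∣<k : ∣ A ∣ < k
          ∣A∣<k = subst (∣ A ∣ <_) (∣block∣ 0 k (m + (m + 2))) (x∈p⇒∣p-x∣<∣p∣ (∈-block 0 (m + (m + 2)) e))
          D⊆ : ∀ v → enc v ∈ D → enc v ∈ A ∪ (⁅ enc vt ⁆ ∪ ⁅ enc w ⁆)
          D⊆ (vx a) v∈D = x∈p∪q⁺ (inj₁ (x∈p∧x≢y⇒x∈p-y (∈-block 0 (m + (m + 2)) a)
                            (λ a≡e → proj₂ (some-x-missing t∈D) (subst (_∈ D) a≡e v∈D))))
          D⊆ (vc a) v∈D = ⊥-elim (noC a v∈D)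
          D⊆ (vq a) v∈D = x∈p∪q⁺ (inj₂ (x∈p∪q⁺ (inj₂ (in-w (q∈Q⁺ a) v∈D))))
          D⊆ vr     v∈D = x∈p∪q⁺ (inj₂ (x∈p∪q⁺ (inj₂ (in-w r∈Q⁺ v∈D))))
          D⊆ vt     _   = x∈p∪q⁺ (inj₂ (x∈p∪q⁺ (inj₁ (x∈⁅x⁆ _))))

        small : Small D
        small = case enc vt ∈? D of λ where
          (yes t∈D) → with-t t∈D
          (no t∉D)  → without-t t∉D

    Q⁺-member? : (Σ V λ w → Q⁺ w × enc w ∈ D) ⊎ (∀ {w} → Q⁺ w → enc w ∉ D)
    Q⁺-member? = case enc vr ∈? D of λ where
      (yes r∈D) → inj₁ (vr , r∈Q⁺ , r∈D)
      (no r∉D)  → case any? (λ l → enc (vq l) ∈? D) of λ where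
        (yes (l , l∈D)) → inj₁ (vq l , q∈Q⁺ l , l∈D)
        (no ¬q)         → inj₂ λ { r∈Q⁺ → r∉D ; (q∈Q⁺ l) l∈D → ¬q (l , l∈D) }

    classify : (∃[ b ] D ≡ S b) ⊎ Small D
    classify = case any? (λ a → enc (vc a) ∈? D) of λ where
      (yes (a , c∈D)) →
        [ (λ (w , qw , w∈D) → inj₂ (with-c-and-Q⁺ c∈D qw w∈D)) , inj₁ ∘ without-Q⁺ ] Q⁺-member?
      (no ¬c) → case any? (λ b → enc (vx b) ∈? D) of λ where
        (yes (b , x∈D)) → inj₂ (WithoutC.WithX.small (λ a c∈D → ¬c (a , c∈D)) b x∈D)
        (no ¬x)         → inj₂ (WithoutC.without-X (λ a c∈D → ¬c (a , c∈D)) (λ b x∈D → ¬x (b , x∈D)))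

  module _ (k≥1 : 1 ≤ k) (k≤m′ : k ≤ m′) where

    -- Here k < m is used: small sets are smaller than the S_i.
    small<size : ∀ {D} → Small D → ∣ D ∣ < suc m
    small<size small = s≤s (≤-trans small (s≤s k≤m′))

    open ΓSetsByClassification G S S-minimal ∣S∣
      (λ D md → Sum.map₂ (small<size {D}) (Classification.classify k≥1 D md))

    -- x_i ∈ S_j forces i = j.
    S-injective : ∀ {i j} → S i ≡ S j → i ≡ j
    S-injective {i} {j} Si≡Sj with S⁻V (vx i) (subst (enc (vx i) ∈_) Si≡Sj (x∈S i))
    ... | inj₂ refl = refl

    ΓGraph-edge⁺ : ∀ i j → H ⊢ i ~ j → ΓAdj G (S i) (S j)
    ΓGraph-edge⁺ i j i~j = enc (vx i) , enc (vx j) , x∈S i , x∈S j , edge⁺ {vx i} {vx j} i~j , S-swap i j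

    -- Swapping out some c_a would remove c_a from S_j, and swapping x_i for
    -- anything but x_j would lose x_j.
    ΓGraph-edge⁻ : ∀ i j → ΓAdj G (S i) (S j) → H ⊢ i ~ j
    ΓGraph-edge⁻ i j (u , w , u∈S , _ , u~w , Sj≡) with S⁻ u∈S
    ... | inj₁ (a , refl) = ⊥-elim (swap-removes G u~w (subst (enc (vc a) ∈_) Sj≡ (c∈S a)))
    ... | inj₂ refl with x∈p∪q⁻ (S i - enc (vx i)) ⁅ w ⁆ (subst (enc (vx j) ∈_) Sj≡ (x∈S j))
    ...   | inj₂ x∈⁅w⁆ = edge⁻ {vx i} {vx j} (subst (G ⊢ enc (vx i) ~_) (≡-sym (x∈⁅y⁆⇒x≡y w x∈⁅w⁆)) u~w)
    ...   | inj₁ x∈S-x with S⁻V (vx j) (p─q⊆p (S i) _ x∈S-x)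
    ...     | inj₂ refl = ⊥-elim (x∉p-x (S i) _ x∈S-x)

    ΓGraph≅H : ΓGraphIso G H
    ΓGraph≅H = S , f-Γ , S-injective , f-onto (fromℕ< k≥1)
             , λ i j → ΓGraph-edge⁺ i j , ΓGraph-edge⁻ i j

-- Take m = |H| + (total size of Gs) + 1: then G(H, m) has Γ-graph H and more
-- vertices than any graph in Gs.
theorem9 : (H : Graph) → 0 < n H → (Gs : List Graph) →
    Σ Graph (λ G → ΓGraphIso G H × All (λ G′ → ¬ (G ≅ G′)) Gs)
theorem9 H 0<k Gs = G , ΓGraph≅H 0<k (m≤m+n k (totalOrder Gs)) , too-large G Gs larger
  where
  open Gadget H (n H + totalOrder Gs)
  larger : totalOrder Gs < N
  larger = ≤-trans (s≤s (m≤n+m (totalOrder Gs) k)) (≤-trans (m≤m+n m (m + 2)) (m≤n+m (m + (m + 2)) k))
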